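{- Let $p$ be a prime, $n\geq2$ an integer and $H\subseteq\mathrm{SL}_2(\mathbb{Z}/p^n\mathbb{Z})$ a slim subgroup. Let $s,t$ be integers with $1\leq t<s\leq n$, and assume $t\geq2$ if $p=2$. Then $\#(H_t/H_s)\leq p^{2(s-t)}$.
   Context: A subgroup $H\subseteq\mathrm{SL}_2(\mathbb{Z}/p^n\mathbb{Z})$ is slim if $H\not\supseteq(1+p^{n-1}\mathrm{M}_2(\mathbb{Z}/p^n\mathbb{Z}))^{\det=1}$, where $S^{\det=1}$ denotes the determinant-$1$ elements of $S$. For $1\leq s\leq n$, $H_s:=H\cap(1+p^s\mathrm{M}_2(\mathbb{Z}/p^n\mathbb{Z}))$, the kernel of reduction mod $p^s$ on $H$. -}

module Defs where

open import Data.Nat using (ℕ; zero; suc; _+_; _*_; _∸_; _^_; _%_; NonZero; _≡ᵇ_)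
open import Data.Nat.Properties using (m^n≢0)
open import Data.Nat.DivMod using (_mod_)
open import Data.Fin using (Fin; toℕ)
open import Data.List using (List; []; _∷_; concatMap; filterᵇ; length; allFin)
open import Data.Bool using (Bool; true; false; _∧_)
open import Relation.Binary.PropositionalEquality using (_≡_)
open import Relation.Nullary using (¬_)
open import Data.Product using (Σ; _×_)

module _ (N : ℕ) .{{_ : NonZero N}} where

  Zmod : Set
  Zmod = Fin N

  _+ₘ_ : Zmod → Zmod → Zmod
  a +ₘ b = (toℕ a + toℕ b) mod N

  _*ₘ_ : Zmod → Zmod → Zmod
  a *ₘ b = (toℕ a * toℕ b) mod N

  _-ₘ_ : Zmod → Zmod → Zmod
  a -ₘ b = (toℕ a + (N ∸ toℕ b)) mod N

  0ₘ 1ₘ : Zmod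
  0ₘ = 0 mod N
  1ₘ = 1 mod N

  record Mat : Set where
    constructor mat
    field
      a b c d : Zmod

  idM : Mat
  idM = mat 1ₘ 0ₘ 0ₘ 1ₘ

  _·_ : Mat → Mat → Mat
  mat a b c d · mat a' b' c' d' =
    mat ((a *ₘ a') +ₘ (b *ₘ c')) ((a *ₘ b') +ₘ (b *ₘ d'))
        ((c *ₘ a') +ₘ (d *ₘ c')) ((c *ₘ b') +ₘ (d *ₘ d'))

  det : Mat → Zmod
  det (mat a b c d) = (a *ₘ d) -ₘ (b *ₘ c)

  allMats : List Mat
  allMats = concatMap (λ a → concatMap (λ b → concatMap (λ c → concatMap (λ d →
              mat a b c d ∷ []) (allFin N)) (allFin N)) (allFin N)) (allFin N)

  count : (Mat → Bool) → ℕ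
  count P = length (filterᵇ P allMats)

  HasInvIn : (Mat → Bool) → Mat → Set
  HasInvIn H A = Σ Mat (λ B → (H B ≡ true) × ((A · B ≡ idM) × (B · A ≡ idM)))

  record IsSubgroupSL₂ (H : Mat → Bool) : Set where
    field
      ⊆SL₂     : ∀ A → H A ≡ true → det A ≡ 1ₘ
      has-id   : H idM ≡ true
      closed·  : ∀ A B → H A ≡ true → H B ≡ true → H (A · B) ≡ true
      closed⁻¹ : ∀ A → H A ≡ true → HasInvIn H A

module _ (p : ℕ) .{{_ : NonZero p}} (n : ℕ) where

  instance
    nzN : NonZero (p ^ n)
    nzN = m^n≢0 p n

  MatP : Set
  MatP = Mat (p ^ n)

  -- x ≡ y (mod p^k), for entries of ℤ/p^nℤ (well defined when k ≤ n)
  _≡ᵇ[mod_]_ : Fin (p ^ n) → ℕ → ℕ → Bool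
  x ≡ᵇ[mod k ] y = (_%_ (toℕ x) (p ^ k) {{m^n≢0 p k}}) ≡ᵇ (_%_ y (p ^ k) {{m^n≢0 p k}})

  inKer : ℕ → Mat (p ^ n) → Bool
  inKer k (mat a b c d) =
    (a ≡ᵇ[mod k ] 1) ∧ (b ≡ᵇ[mod k ] 0) ∧ (c ≡ᵇ[mod k ] 0) ∧ (d ≡ᵇ[mod k ] 1)

  Hk : (Mat (p ^ n) → Bool) → ℕ → Mat (p ^ n) → Bool
  Hk H k A = H A ∧ inKer k A

  Slim : (Mat (p ^ n) → Bool) → Set
  Slim H = ¬ (∀ A → det (p ^ n) A ≡ 1ₘ (p ^ n) → inKer (n ∸ 1) A ≡ true → H A ≡ true)

  #H : (Mat (p ^ n) → Bool) → ℕ → ℕ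
  #H H k = count (p ^ n) (Hk H k)

{-# OPTIONS --safe #-}
module Submission where

-- For i ≥ 1 write an element of H_i as A = 1 + pⁱX.  Its class X mod p is traceless
-- (det A = 1), and A ↦ X mod p is additive on H_i with kernel H_{i+1}, so the classes
-- of H_i form a subspace of sl₂(𝔽_p) ≅ 𝔽_p³.  Raising to the p-th power sends 1 + pⁱX
-- to 1 + pⁱ⁺¹X mod pⁱ⁺² (the binomial term C(p,2) p²ⁱ X² vanishes as p is odd or
-- i ≥ 2), so if the classes of H_i filled sl₂(𝔽_p) then so would those of H_{n-1},
-- i.e. H ⊇ (1 + pⁿ⁻¹M₂)^{det=1}, contradicting slimness.  Hence some v is not a class,
-- and (A , k) ↦ (class A + k v , R⁻¹A), with R ∈ H_i of the same class as A, embeds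
-- H_i × 𝔽_p into 𝔽_p³ × H_{i+1}: #H_i ≤ p² #H_{i+1}.

open import Defs
open import Data.Bool using (Bool; true; T)
open import Data.Bool.Properties using (T-∧; T-≡; T?)
open import Data.Empty using (⊥-elim)
open import Data.Fin as Fin using (Fin; toℕ)
open import Data.Fin.Properties using (toℕ-fromℕ<; toℕ-injective; toℕ<n; injective⇒≤) renaming (_≟_ to _≟ᶠ_)
open import Data.List using (List; []; _∷_; [_]; _++_; map; concatMap; filterᵇ; cartesianProduct; allFin; length; lookup)
open import Data.List.Membership.Propositional using (_∈_; find; lose)
open import Data.List.Membership.Propositional.Properties
  using (∈-lookup; ∈-map⁺; ∈-filter⁺; ∈-filter⁻; ∈-cartesianProduct⁺; ∈-cartesianProduct⁻; ∈-allFin)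
open import Data.List.Properties using (map-++; map-∘; concatMap-cong; length-++; length-map; length-tabulate)
import Data.List.Relation.Unary.All as All
open import Data.List.Relation.Unary.AllPairs using (_∷_)
open import Data.List.Relation.Unary.Any using (Any; any?; index)
open import Data.List.Relation.Unary.Any.Properties using (lookup-index)
open import Data.List.Relation.Unary.Unique.Propositional using (Unique)
open import Data.List.Relation.Unary.Unique.Propositional.Properties using (map⁺; filter⁺; cartesianProduct⁺; allFin⁺)
open import Data.Nat
open import Data.Nat.Combinatorics using (_C_; nC1≡n; nCk+nC[k+1]≡[n+1]C[k+1])
open import Data.Nat.Coprimality as Coprimality using (prime⇒coprime; coprime-Bézout)
open import Data.Nat.DivMod
open import Data.Nat.Divisibility using (_∣_; divides; ∣-refl; ∣m+n∣m⇒∣n; m∣m*n; n∣m*n; ∣m⇒∣m*n; *-monoˡ-∣)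
open import Data.Nat.GCD using (module Bézout)
open import Data.Nat.Primality using (Prime; euclidsLemma; irreducible[2]; prime⇒nonTrivial)
open import Data.Nat.Properties
open import Data.Nat.Tactic.RingSolver using (solve)
open import Data.Product using (∃; ∃₂; ∃-syntax; _×_; _,_; proj₁; proj₂)
open import Data.Product.Properties using (≡-dec)
open import Data.Sum using (inj₁; inj₂)
open import Function using (_∘_; id)
open import Function.Bundles using (_⇔_; mk⇔; Equivalence)
open import Level using (0ℓ)
open import Relation.Binary.Bundles using (Setoid)
open import Relation.Binary.Definitions using (DecidableEquality; tri<; tri≈; tri>)
open import Relation.Binary.PropositionalEquality
  using (_≡_; _≢_; refl; sym; trans; cong; cong₂; subst; subst₂; module ≡-Reasoning)
import Relation.Binary.Reasoning.Setoid as SetoidReasoning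
open import Relation.Nullary using (¬_; yes; no)
open import Relation.Nullary.Decidable using (decidable-stable)

-- Congruences of natural numbers

infix 4 _≡_[mod_]

_≡_[mod_] : ℕ → ℕ → ℕ → Set
x ≡ y [mod m ] = ∃₂ λ a b → x + a * m ≡ y + b * m

module _ {m : ℕ} where

  mod-refl : ∀ {x} → x ≡ x [mod m ]
  mod-refl = 0 , 0 , refl

  mod-reflexive : ∀ {x y} → x ≡ y → x ≡ y [mod m ]
  mod-reflexive refl = mod-refl

  mod-sym : ∀ {x y} → x ≡ y [mod m ] → y ≡ x [mod m ]
  mod-sym (a , b , e) = b , a , sym e

  mod-trans : ∀ {x y z} → x ≡ y [mod m ] → y ≡ z [mod m ] → x ≡ z [mod m ]
  mod-trans {x} {y} {z} (a , b , e) (c , d , f) = a + c , d + b , (begin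
    x + (a + c) * m       ≡⟨ solve (x ∷ a ∷ c ∷ m ∷ []) ⟩
    (x + a * m) + c * m   ≡⟨ cong (_+ c * m) e ⟩
    (y + b * m) + c * m   ≡⟨ solve (y ∷ b ∷ c ∷ m ∷ []) ⟩
    (y + c * m) + b * m   ≡⟨ cong (_+ b * m) f ⟩
    (z + d * m) + b * m   ≡⟨ solve (z ∷ d ∷ b ∷ m ∷ []) ⟩
    z + (d + b) * m       ∎)
    where open ≡-Reasoning

  mod-+-multiple : ∀ x k → x + k * m ≡ x [mod m ]
  mod-+-multiple x k = 0 , k , +-identityʳ _

  mod-+ : ∀ {x y z w} → x ≡ y [mod m ] → z ≡ w [mod m ] → x + z ≡ y + w [mod m ]
  mod-+ {x} {y} {z} {w} (a , b , e) (c , d , f) = a + c , b + d , (begin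
    x + z + (a + c) * m          ≡⟨ solve (x ∷ z ∷ a ∷ c ∷ m ∷ []) ⟩
    (x + a * m) + (z + c * m)    ≡⟨ cong₂ _+_ e f ⟩
    (y + b * m) + (w + d * m)    ≡⟨ solve (y ∷ w ∷ b ∷ d ∷ m ∷ []) ⟩
    y + w + (b + d) * m          ∎)
    where open ≡-Reasoning

  mod-+-cancelʳ : ∀ {x y} z → x + z ≡ y + z [mod m ] → x ≡ y [mod m ]
  mod-+-cancelʳ {x} {y} z (a , b , e) = a , b , +-cancelʳ-≡ z _ _ (begin
    x + a * m + z     ≡⟨ solve (x ∷ a ∷ m ∷ z ∷ []) ⟩
    x + z + a * m     ≡⟨ e ⟩
    y + z + b * m     ≡⟨ solve (y ∷ z ∷ b ∷ m ∷ []) ⟩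
    y + b * m + z     ∎)
    where open ≡-Reasoning

  mod-+-cancelˡ : ∀ {x y} z → z + x ≡ z + y [mod m ] → x ≡ y [mod m ]
  mod-+-cancelˡ {x} {y} z = mod-+-cancelʳ z ∘ subst₂ (_≡_[mod m ]) (+-comm z x) (+-comm z y)

  mod-*ʳ : ∀ {x y} z → x ≡ y [mod m ] → x * z ≡ y * z [mod m ]
  mod-*ʳ {x} {y} z (a , b , e) = a * z , b * z , (begin
    x * z + a * z * m    ≡⟨ solve (x ∷ z ∷ a ∷ m ∷ []) ⟩
    (x + a * m) * z      ≡⟨ cong (_* z) e ⟩
    (y + b * m) * z      ≡⟨ solve (y ∷ z ∷ b ∷ m ∷ []) ⟩
    y * z + b * z * m    ∎)
    where open ≡-Reasoning

  mod-* : ∀ {x y z w} → x ≡ y [mod m ] → z ≡ w [mod m ] → x * z ≡ y * w [mod m ]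
  mod-* {x} {y} {z} {w} x≡y z≡w = mod-trans (mod-*ʳ z x≡y)
    (subst₂ (_≡_[mod m ]) (*-comm z y) (*-comm w y) (mod-*ʳ y z≡w))

  module _ .{{_ : NonZero m}} where

    %-mod : ∀ x → x % m ≡ x [mod m ]
    %-mod x = x / m , 0 , trans (sym (m≡m%n+[m/n]*n x m)) (sym (+-identityʳ x))

    mod⇒%≡ : ∀ {x y} → x ≡ y [mod m ] → x % m ≡ y % m
    mod⇒%≡ {x} {y} (a , b , e) = begin
      x % m              ≡⟨ [m+kn]%n≡m%n x a m ⟨
      (x + a * m) % m    ≡⟨ cong (_% m) e ⟩
      (y + b * m) % m    ≡⟨ [m+kn]%n≡m%n y b m ⟩
      y % m              ∎
      where open ≡-Reasoning

    %≡⇒mod : ∀ {x y} → x % m ≡ y % m → x ≡ y [mod m ]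
    %≡⇒mod {x} {y} e = mod-trans (mod-sym (%-mod x)) (mod-trans (mod-reflexive e) (%-mod y))

    mod⇒≡ : ∀ {x y} → x < m → y < m → x ≡ y [mod m ] → x ≡ y
    mod⇒≡ {x} {y} x<m y<m x≡y =
      trans (sym (m<n⇒m%n≡m x<m)) (trans (mod⇒%≡ x≡y) (m<n⇒m%n≡m y<m))

mod-∣ : ∀ {m m' x y} → m ∣ m' → x ≡ y [mod m' ] → x ≡ y [mod m ]
mod-∣ {m} {_} {x} {y} (divides q refl) (a , b , e) = a * q , b * q ,
  trans (cong (x +_) (*-assoc a q m)) (trans e (cong (y +_) (sym (*-assoc b q m))))

mod-scale : ∀ {m x y} c → x ≡ y [mod m ] → c * x ≡ c * y [mod m * c ]
mod-scale {m} {x} {y} c (a , b , e) = a , b , (begin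
  c * x + a * (m * c)   ≡⟨ solve (c ∷ x ∷ a ∷ m ∷ []) ⟩
  c * (x + a * m)       ≡⟨ cong (c *_) e ⟩
  c * (y + b * m)       ≡⟨ solve (c ∷ y ∷ b ∷ m ∷ []) ⟩
  c * y + b * (m * c)   ∎)
  where open ≡-Reasoning

mod-*-cancelˡ : ∀ {c m x y} .{{_ : NonZero c}} → c * x ≡ c * y [mod m * c ] → x ≡ y [mod m ]
mod-*-cancelˡ {c} {m} {x} {y} (a , b , e) = a , b , *-cancelˡ-≡ _ _ c (begin
  c * (x + a * m)       ≡⟨ solve (c ∷ x ∷ a ∷ m ∷ []) ⟩
  c * x + a * (m * c)   ≡⟨ e ⟩
  c * y + b * (m * c)   ≡⟨ solve (c ∷ y ∷ b ∷ m ∷ []) ⟩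
  c * (y + b * m)       ∎)
  where open ≡-Reasoning

mod-+-∣ : ∀ {m k} x → m ∣ k → x + k ≡ x [mod m ]
mod-+-∣ {m} x (divides q refl) = mod-+-multiple x q

^-monoʳ-∣ : ∀ p {i k} → i ≤ k → p ^ i ∣ p ^ k
^-monoʳ-∣ p {i} {k} i≤k = divides (p ^ (k ∸ i)) (begin
  p ^ k                 ≡⟨ cong (p ^_) (m+[n∸m]≡n i≤k) ⟨
  p ^ (i + (k ∸ i))     ≡⟨ ^-distribˡ-+-* p i (k ∸ i) ⟩
  p ^ i * p ^ (k ∸ i)   ≡⟨ *-comm (p ^ i) _ ⟩
  p ^ (k ∸ i) * p ^ i   ∎)
  where open ≡-Reasoning

modSetoid : ℕ → Setoid 0ℓ 0ℓ
modSetoid m = record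
  { Carrier = ℕ
  ; _≈_ = _≡_[mod m ]
  ; isEquivalence = record { refl = mod-refl ; sym = mod-sym ; trans = mod-trans }
  }

module ≡-mod-Reasoning (m : ℕ) = SetoidReasoning (modSetoid m)

toℕ-mod : ∀ x m .{{_ : NonZero m}} → toℕ (x mod m) ≡ x [mod m ]
toℕ-mod x m = mod-trans (mod-reflexive (toℕ-fromℕ< _)) (%-mod x)

mod≡⇒mod : ∀ {m x y} .{{_ : NonZero m}} → x mod m ≡ y mod m → x ≡ y [mod m ]
mod≡⇒mod {m} {x} {y} e = mod-trans (mod-sym (toℕ-mod x m)) (mod-trans (mod-reflexive (cong toℕ e)) (toℕ-mod y m))

mod⇒mod≡ : ∀ {m x y} .{{_ : NonZero m}} → x ≡ y [mod m ] → x mod m ≡ y mod m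
mod⇒mod≡ {m} {x} {y} e = toℕ-injective (mod⇒≡ (toℕ<n _) (toℕ<n _)
  (mod-trans (toℕ-mod x m) (mod-trans e (mod-sym (toℕ-mod y m)))))

inverse-mod : ∀ {p} → Prime p → ∀ {d} .{{_ : NonZero d}} → d < p → ∃ λ e → e * d ≡ 1 [mod p ]
inverse-mod {p} pr {d} d<p with coprime-Bézout (Coprimality.sym (prime⇒coprime pr d<p))
... | Bézout.+- x y 1+yp≡xd = x , 0 , y , trans (+-identityʳ (x * d)) (sym 1+yp≡xd)
-- Here x d ≡ -1 (mod p), so (p - 1) x inverts d.
inverse-mod {suc q} pr {d} d<p | Bézout.-+ x y 1+xd≡yp = q * x , 1 , q * y , (begin
  q * x * d + 1 * suc q      ≡⟨ solve (q ∷ x ∷ d ∷ []) ⟩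
  q * (1 + x * d) + 1        ≡⟨ cong (λ z → q * z + 1) 1+xd≡yp ⟩
  q * (y * suc q) + 1        ≡⟨ solve (q ∷ y ∷ []) ⟩
  1 + q * y * suc q          ∎)
  where open ≡-Reasoning

[1+n]C2≡n+nC2 : ∀ k → suc k C 2 ≡ k + (k C 2)
[1+n]C2≡n+nC2 k = trans (sym (nCk+nC[k+1]≡[n+1]C[k+1] k 1)) (cong (_+ (k C 2)) (nC1≡n k))

n+2*nC2≡n*n : ∀ k → k + 2 * (k C 2) ≡ k * k
n+2*nC2≡n*n zero    = refl
n+2*nC2≡n*n (suc k) = begin
  suc k + 2 * (suc k C 2)      ≡⟨ cong (λ c → suc k + 2 * c) ([1+n]C2≡n+nC2 k) ⟩
  suc k + 2 * (k + (k C 2))    ≡⟨ regroup (k C 2) ⟩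
  suc (k + k) + (k + 2 * (k C 2))  ≡⟨ cong (suc (k + k) +_) (n+2*nC2≡n*n k) ⟩
  suc (k + k) + k * k          ≡⟨ solve (k ∷ []) ⟩
  suc k * suc k                ∎
  where
  open ≡-Reasoning
  regroup : ∀ c → suc k + 2 * (k + c) ≡ suc (k + k) + (k + 2 * c)
  regroup c = solve (k ∷ c ∷ [])

-- p divides p (p - 1) = 2 C(p,2) but not 2.
p∣pC2 : ∀ {p} → Prime p → p ≢ 2 → p ∣ p C 2
p∣pC2 {p} pr p≢2 with euclidsLemma 2 (p C 2) pr (∣m+n∣m⇒∣n (subst (p ∣_) (sym (n+2*nC2≡n*n p)) (m∣m*n p)) ∣-refl)
... | inj₂ p∣pC2 = p∣pC2
... | inj₁ p∣2 with irreducible[2] p∣2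
...   | inj₂ p≡2 = ⊥-elim (p≢2 p≡2)
...   | inj₁ refl = ⊥-elim (<-irrefl refl (nonTrivial⇒n>1 1 {{prime⇒nonTrivial pr}}))

p^[3+j]∣pC2*p^[1+j]² : ∀ {p} j → Prime p → (p ≡ 2 → 1 ≤ j) →
  p ^ (3 + j) ∣ (p C 2) * (p ^ suc j * p ^ suc j)
p^[3+j]∣pC2*p^[1+j]² {p} j pr p≡2⇒1≤j with p ≟ 2
... | no p≢2 with p∣pC2 pr p≢2
...   | divides q pC2≡q*p = divides (q * p ^ j) (begin
          (p C 2) * (p ^ suc j * p ^ suc j)    ≡⟨ cong (_* (p ^ suc j * p ^ suc j)) pC2≡q*p ⟩
          q * p * (p * p ^ j * (p * p ^ j))    ≡⟨ regroup q (p ^ j) ⟩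
          q * p ^ j * p ^ (3 + j)              ∎)
  where
  open ≡-Reasoning
  regroup : ∀ q P → q * p * (p * P * (p * P)) ≡ q * P * (p * (p * (p * P)))
  regroup q P = solve (q ∷ p ∷ P ∷ [])
p^[3+j]∣pC2*p^[1+j]² {.2} (suc j) pr p≡2⇒1≤j | yes refl = divides (2 ^ j) (regroup (2 ^ j))
  where
  regroup : ∀ P → 1 * (2 * (2 * P) * (2 * (2 * P))) ≡ P * (2 * (2 * (2 * (2 * P))))
  regroup P = solve (P ∷ [])
p^[3+j]∣pC2*p^[1+j]² {.2} zero pr p≡2⇒1≤j | yes refl with () ← p≡2⇒1≤j refl

-- 2 × 2 matrices over ℕ

record ℕMat : Set where
  constructor nmat
  field a b c d : ℕ

infixl 6 _+ᴹ_
infixl 7 _*ᴹ_ _•_ _/ᴹ_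
infix 4 _≈_[mod_]

_*ᴹ_ : ℕMat → ℕMat → ℕMat
nmat a b c d *ᴹ nmat a' b' c' d' =
  nmat (a * a' + b * c') (a * b' + b * d') (c * a' + d * c') (c * b' + d * d')

_+ᴹ_ : ℕMat → ℕMat → ℕMat
nmat a b c d +ᴹ nmat a' b' c' d' = nmat (a + a') (b + b') (c + c') (d + d')

_•_ : ℕ → ℕMat → ℕMat
k • nmat a b c d = nmat (k * a) (k * b) (k * c) (k * d)

0ᴹ 1ᴹ : ℕMat
0ᴹ = nmat 0 0 0 0
1ᴹ = nmat 1 0 0 1

_^ᴹ_ : ℕMat → ℕ → ℕMat
X ^ᴹ zero  = 1ᴹ
X ^ᴹ suc k = X *ᴹ X ^ᴹ k

trace : ℕMat → ℕ
trace (nmat a _ _ d) = a + d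

_/ᴹ_ : ℕMat → (m : ℕ) → .{{NonZero m}} → ℕMat
nmat a b c d /ᴹ m = nmat (a / m) (b / m) (c / m) (d / m)

-- det X ≡ 1 (mod m), with b c moved across to avoid truncated subtraction.
Det≡1[mod_] : ℕ → ℕMat → Set
Det≡1[mod m ] (nmat a b c d) = a * d ≡ 1 + b * c [mod m ]

_≈_[mod_] : ℕMat → ℕMat → ℕ → Set
nmat a b c d ≈ nmat a' b' c' d' [mod m ] =
  a ≡ a' [mod m ] × b ≡ b' [mod m ] × c ≡ c' [mod m ] × d ≡ d' [mod m ]

nmat-cong : ∀ {a b c d a' b' c' d'} → a ≡ a' → b ≡ b' → c ≡ c' → d ≡ d' →
            nmat a b c d ≡ nmat a' b' c' d'
nmat-cong refl refl refl refl = refl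

•-zeroʳ : ∀ k → k • 0ᴹ ≡ 0ᴹ
•-zeroʳ k = nmat-cong (*-zeroʳ k) (*-zeroʳ k) (*-zeroʳ k) (*-zeroʳ k)

+ᴹ-comm : ∀ X Y → X +ᴹ Y ≡ Y +ᴹ X
+ᴹ-comm (nmat a b c d) (nmat a' b' c' d') = nmat-cong (+-comm a a') (+-comm b b') (+-comm c c') (+-comm d d')

+ᴹ-assoc : ∀ X Y Z → X +ᴹ Y +ᴹ Z ≡ X +ᴹ (Y +ᴹ Z)
+ᴹ-assoc (nmat a b c d) (nmat a' b' c' d') (nmat a'' b'' c'' d'') =
  nmat-cong (+-assoc a a' a'') (+-assoc b b' b'') (+-assoc c c' c'') (+-assoc d d' d'')

+ᴹ-identityʳ : ∀ X → X +ᴹ 0ᴹ ≡ X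
+ᴹ-identityʳ (nmat a b c d) = nmat-cong (+-identityʳ a) (+-identityʳ b) (+-identityʳ c) (+-identityʳ d)

•-assoc : ∀ k l X → k • (l • X) ≡ (k * l) • X
•-assoc k l (nmat a b c d) = nmat-cong (sym (*-assoc k l a)) (sym (*-assoc k l b)) (sym (*-assoc k l c)) (sym (*-assoc k l d))

•-identityˡ : ∀ X → 1 • X ≡ X
•-identityˡ (nmat a b c d) = nmat-cong (*-identityˡ a) (*-identityˡ b) (*-identityˡ c) (*-identityˡ d)

•-distribʳ : ∀ k l X → (k + l) • X ≡ k • X +ᴹ l • X
•-distribʳ k l (nmat a b c d) = nmat-cong (*-distribʳ-+ a k l) (*-distribʳ-+ b k l) (*-distribʳ-+ c k l) (*-distribʳ-+ d k l)

trace-+ᴹ : ∀ X Y → trace (X +ᴹ Y) ≡ trace X + trace Y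
trace-+ᴹ (nmat a b c d) (nmat a' b' c' d') = interchange a a' d d'
  where
  interchange : ∀ w x y z → (w + x) + (y + z) ≡ (w + y) + (x + z)
  interchange w x y z = solve (w ∷ x ∷ y ∷ z ∷ [])

trace-• : ∀ k X → trace (k • X) ≡ k * trace X
trace-• k (nmat a b c d) = sym (*-distribˡ-+ k a d)

*ᴹ-assoc : ∀ X Y Z → (X *ᴹ Y) *ᴹ Z ≡ X *ᴹ (Y *ᴹ Z)
*ᴹ-assoc (nmat a b c d) (nmat e f g h) (nmat i j k l) =
  nmat-cong (entry a b i k) (entry a b j l) (entry c d i k) (entry c d j l)
  where
  entry : ∀ x y z w → (x * e + y * g) * z + (x * f + y * h) * w ≡ x * (e * z + f * w) + y * (g * z + h * w)
  entry x y z w = solve (x ∷ y ∷ z ∷ w ∷ e ∷ f ∷ g ∷ h ∷ [])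

*ᴹ-identityˡ : ∀ X → 1ᴹ *ᴹ X ≡ X
*ᴹ-identityˡ (nmat a b c d) = nmat-cong (entry a c) (entry b d) (entry' a c) (entry' b d)
  where
  entry : ∀ x y → 1 * x + 0 * y ≡ x
  entry x y = solve (x ∷ y ∷ [])
  entry' : ∀ x y → 0 * x + 1 * y ≡ y
  entry' x y = solve (x ∷ y ∷ [])

module _ {m : ℕ} where

  ≈-refl : ∀ {X} → X ≈ X [mod m ]
  ≈-refl = mod-refl , mod-refl , mod-refl , mod-refl

  ≈-reflexive : ∀ {X Y} → X ≡ Y → X ≈ Y [mod m ]
  ≈-reflexive refl = ≈-refl

  ≈-sym : ∀ {X Y} → X ≈ Y [mod m ] → Y ≈ X [mod m ]
  ≈-sym (ea , eb , ec , ed) = mod-sym ea , mod-sym eb , mod-sym ec , mod-sym ed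

  ≈-trans : ∀ {X Y Z} → X ≈ Y [mod m ] → Y ≈ Z [mod m ] → X ≈ Z [mod m ]
  ≈-trans (ea , eb , ec , ed) (fa , fb , fc , fd) =
    mod-trans ea fa , mod-trans eb fb , mod-trans ec fc , mod-trans ed fd

  +ᴹ-cong : ∀ {X X' Y Y'} → X ≈ X' [mod m ] → Y ≈ Y' [mod m ] → X +ᴹ Y ≈ X' +ᴹ Y' [mod m ]
  +ᴹ-cong (ea , eb , ec , ed) (fa , fb , fc , fd) =
    mod-+ ea fa , mod-+ eb fb , mod-+ ec fc , mod-+ ed fd

  *ᴹ-cong : ∀ {X X' Y Y'} → X ≈ X' [mod m ] → Y ≈ Y' [mod m ] → X *ᴹ Y ≈ X' *ᴹ Y' [mod m ]
  *ᴹ-cong (ea , eb , ec , ed) (fa , fb , fc , fd) =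
    mod-+ (mod-* ea fa) (mod-* eb fc) , mod-+ (mod-* ea fb) (mod-* eb fd) ,
    mod-+ (mod-* ec fa) (mod-* ed fc) , mod-+ (mod-* ec fb) (mod-* ed fd)

  •-congʳ : ∀ {k l} X → k ≡ l [mod m ] → k • X ≈ l • X [mod m ]
  •-congʳ X k≡l = mod-*ʳ _ k≡l , mod-*ʳ _ k≡l , mod-*ʳ _ k≡l , mod-*ʳ _ k≡l

  +ᴹ-cancelʳ : ∀ {X Y} Z → X +ᴹ Z ≈ Y +ᴹ Z [mod m ] → X ≈ Y [mod m ]
  +ᴹ-cancelʳ Z (ea , eb , ec , ed) =
    mod-+-cancelʳ _ ea , mod-+-cancelʳ _ eb , mod-+-cancelʳ _ ec , mod-+-cancelʳ _ ed

  +ᴹ-cancelˡ : ∀ {X Y} Z → Z +ᴹ X ≈ Z +ᴹ Y [mod m ] → X ≈ Y [mod m ]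
  +ᴹ-cancelˡ Z (ea , eb , ec , ed) =
    mod-+-cancelˡ _ ea , mod-+-cancelˡ _ eb , mod-+-cancelˡ _ ec , mod-+-cancelˡ _ ed

  +ᴹ-∣ : ∀ {k} X → m ∣ k → ∀ W → X +ᴹ k • W ≈ X [mod m ]
  +ᴹ-∣ X m∣k W = mod-+-∣ _ (∣m⇒∣m*n _ m∣k) , mod-+-∣ _ (∣m⇒∣m*n _ m∣k) ,
                 mod-+-∣ _ (∣m⇒∣m*n _ m∣k) , mod-+-∣ _ (∣m⇒∣m*n _ m∣k)

≈-∣ : ∀ {m m' X Y} → m ∣ m' → X ≈ Y [mod m' ] → X ≈ Y [mod m ]
≈-∣ m∣m' (ea , eb , ec , ed) = mod-∣ m∣m' ea , mod-∣ m∣m' eb , mod-∣ m∣m' ec , mod-∣ m∣m' ed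

•-scale : ∀ {m X Y} c → X ≈ Y [mod m ] → c • X ≈ c • Y [mod m * c ]
•-scale c (ea , eb , ec , ed) = mod-scale c ea , mod-scale c eb , mod-scale c ec , mod-scale c ed

•-cancelˡ : ∀ {c m} X Y .{{_ : NonZero c}} → c • X ≈ c • Y [mod m * c ] → X ≈ Y [mod m ]
•-cancelˡ X Y (ea , eb , ec , ed) =
  mod-*-cancelˡ ea , mod-*-cancelˡ eb , mod-*-cancelˡ ec , mod-*-cancelˡ ed

≈-setoid : ℕ → Setoid 0ℓ 0ℓ
≈-setoid m = record
  { Carrier = ℕMat
  ; _≈_ = _≈_[mod m ]
  ; isEquivalence = record { refl = ≈-refl ; sym = ≈-sym ; trans = ≈-trans }
  }

module ≈-Reasoning (m : ℕ) = SetoidReasoning (≈-setoid m)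

[1+uX][1+uY] : ∀ u X Y →
  (1ᴹ +ᴹ u • X) *ᴹ (1ᴹ +ᴹ u • Y) ≡ 1ᴹ +ᴹ u • (X +ᴹ Y) +ᴹ (u * u) • (X *ᴹ Y)
[1+uX][1+uY] u (nmat a b c d) (nmat a' b' c' d') = nmat-cong eᵃ eᵇ eᶜ eᵈ
  where
  eᵃ : (1 + u * a) * (1 + u * a') + (0 + u * b) * (0 + u * c') ≡ 1 + u * (a + a') + u * u * (a * a' + b * c')
  eᵃ = solve (u ∷ a ∷ b ∷ a' ∷ c' ∷ [])
  eᵇ : (1 + u * a) * (0 + u * b') + (0 + u * b) * (1 + u * d') ≡ 0 + u * (b + b') + u * u * (a * b' + b * d')
  eᵇ = solve (u ∷ a ∷ b ∷ b' ∷ d' ∷ [])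
  eᶜ : (0 + u * c) * (1 + u * a') + (1 + u * d) * (0 + u * c') ≡ 0 + u * (c + c') + u * u * (c * a' + d * c')
  eᶜ = solve (u ∷ c ∷ d ∷ a' ∷ c' ∷ [])
  eᵈ : (0 + u * c) * (0 + u * b') + (1 + u * d) * (1 + u * d') ≡ 1 + u * (d + d') + u * u * (c * b' + d * d')
  eᵈ = solve (u ∷ c ∷ d ∷ b' ∷ d' ∷ [])

[1+uX]^k-step : ∀ u X k c →
  (1ᴹ +ᴹ u • X) *ᴹ (1ᴹ +ᴹ (k * u) • X +ᴹ (c * (u * u)) • (X *ᴹ X)) ≡
  1ᴹ +ᴹ (suc k * u) • X +ᴹ ((k + c) * (u * u)) • (X *ᴹ X) +ᴹ (u * u * u) • (c • (X *ᴹ (X *ᴹ X)))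
[1+uX]^k-step u (nmat a b c d) k m = nmat-cong eᵃ eᵇ eᶜ eᵈ
  where
  eᵃ : (1 + u * a) * (1 + k * u * a + m * (u * u) * (a * a + b * c))
       + (0 + u * b) * (0 + k * u * c + m * (u * u) * (c * a + d * c))
     ≡ 1 + suc k * u * a + (k + m) * (u * u) * (a * a + b * c)
       + u * u * u * (m * (a * (a * a + b * c) + b * (c * a + d * c)))
  eᵃ = solve (u ∷ a ∷ b ∷ c ∷ d ∷ k ∷ m ∷ [])
  eᵇ : (1 + u * a) * (0 + k * u * b + m * (u * u) * (a * b + b * d))
       + (0 + u * b) * (1 + k * u * d + m * (u * u) * (c * b + d * d))
     ≡ 0 + suc k * u * b + (k + m) * (u * u) * (a * b + b * d)
       + u * u * u * (m * (a * (a * b + b * d) + b * (c * b + d * d)))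
  eᵇ = solve (u ∷ a ∷ b ∷ c ∷ d ∷ k ∷ m ∷ [])
  eᶜ : (0 + u * c) * (1 + k * u * a + m * (u * u) * (a * a + b * c))
       + (1 + u * d) * (0 + k * u * c + m * (u * u) * (c * a + d * c))
     ≡ 0 + suc k * u * c + (k + m) * (u * u) * (c * a + d * c)
       + u * u * u * (m * (c * (a * a + b * c) + d * (c * a + d * c)))
  eᶜ = solve (u ∷ a ∷ b ∷ c ∷ d ∷ k ∷ m ∷ [])
  eᵈ : (0 + u * c) * (0 + k * u * b + m * (u * u) * (a * b + b * d))
       + (1 + u * d) * (1 + k * u * d + m * (u * u) * (c * b + d * d))
     ≡ 1 + suc k * u * d + (k + m) * (u * u) * (c * b + d * d)
       + u * u * u * (m * (c * (a * b + b * d) + d * (c * b + d * d)))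
  eᵈ = solve (u ∷ a ∷ b ∷ c ∷ d ∷ k ∷ m ∷ [])

[1+uX]^k : ∀ u X k →
  (1ᴹ +ᴹ u • X) ^ᴹ k ≈ 1ᴹ +ᴹ (k * u) • X +ᴹ ((k C 2) * (u * u)) • (X *ᴹ X) [mod u * u * u ]
[1+uX]^k u X zero = ≈-refl
[1+uX]^k u X (suc k) = begin
  (1ᴹ +ᴹ u • X) *ᴹ (1ᴹ +ᴹ u • X) ^ᴹ k
    ≈⟨ *ᴹ-cong (≈-refl {X = 1ᴹ +ᴹ u • X}) ([1+uX]^k u X k) ⟩
  (1ᴹ +ᴹ u • X) *ᴹ (1ᴹ +ᴹ (k * u) • X +ᴹ ((k C 2) * (u * u)) • (X *ᴹ X))
    ≡⟨ [1+uX]^k-step u X k (k C 2) ⟩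
  1ᴹ +ᴹ (suc k * u) • X +ᴹ ((k + (k C 2)) * (u * u)) • (X *ᴹ X) +ᴹ (u * u * u) • ((k C 2) • (X *ᴹ (X *ᴹ X)))
    ≈⟨ +ᴹ-∣ _ ∣-refl _ ⟩
  1ᴹ +ᴹ (suc k * u) • X +ᴹ ((k + (k C 2)) * (u * u)) • (X *ᴹ X)
    ≡⟨ cong (λ c → 1ᴹ +ᴹ (suc k * u) • X +ᴹ (c * (u * u)) • (X *ᴹ X)) ([1+n]C2≡n+nC2 k) ⟨
  1ᴹ +ᴹ (suc k * u) • X +ᴹ ((suc k C 2) * (u * u)) • (X *ᴹ X) ∎
  where open ≈-Reasoning (u * u * u)

Det≡1-resp-≈ : ∀ {m X Y} → X ≈ Y [mod m ] → Det≡1[mod m ] X → Det≡1[mod m ] Y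
Det≡1-resp-≈ (ea , eb , ec , ed) det = mod-trans (mod-sym (mod-* ea ed)) (mod-trans det (mod-+ mod-refl (mod-* eb ec)))

Det≡1⇒trace≡0 : ∀ {u p} .{{_ : NonZero u}} Y → p ∣ u →
  Det≡1[mod p * u ] (1ᴹ +ᴹ u • Y) → trace Y ≡ 0 [mod p ]
Det≡1⇒trace≡0 {u} {p} (nmat a b c d) p∣u det =
  mod-*-cancelˡ (mod-+-cancelʳ 1 (begin
    u * (a + d) + 1                          ≈⟨ mod-+-∣ _ (p*u∣u*u _) ⟨
    u * (a + d) + 1 + u * u * (a * d)        ≡⟨ solve (u ∷ a ∷ d ∷ []) ⟩
    (1 + u * a) * (1 + u * d)                ≈⟨ det ⟩
    1 + (0 + u * b) * (0 + u * c)            ≡⟨ solve (u ∷ b ∷ c ∷ []) ⟩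
    u * 0 + 1 + u * u * (b * c)              ≈⟨ mod-+-∣ _ (p*u∣u*u _) ⟩
    u * 0 + 1                                ∎))
  where
  open ≡-mod-Reasoning (p * u)
  p*u∣u*u : ∀ k → p * u ∣ u * u * k
  p*u∣u*u k = ∣m⇒∣m*n k (*-monoˡ-∣ u p∣u)

module _ {m : ℕ} .{{_ : NonZero m}} where

  private
    split-entry : ∀ {x r} → r < m → x ≡ r [mod m ] → x ≡ r + m * (x / m)
    split-entry {x} {r} r<m x≡r = begin
      x                    ≡⟨ m≡m%n+[m/n]*n x m ⟩
      x % m + x / m * m    ≡⟨ cong₂ _+_ (trans (mod⇒%≡ x≡r) (m<n⇒m%n≡m r<m)) (*-comm (x / m) m) ⟩
      r + m * (x / m)      ∎
      where open ≡-Reasoning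

  ≈1ᴹ⇒≡1ᴹ+m•[X/m] : 1 < m → ∀ X → X ≈ 1ᴹ [mod m ] → X ≡ 1ᴹ +ᴹ m • (X /ᴹ m)
  ≈1ᴹ⇒≡1ᴹ+m•[X/m] 1<m (nmat a b c d) (ea , eb , ec , ed) = nmat-cong
    (split-entry 1<m ea) (split-entry 0<m eb) (split-entry 0<m ec) (split-entry 1<m ed)
    where
    0<m : 0 < m
    0<m = <-trans z<s 1<m

module Lift (N : ℕ) .{{_ : NonZero N}} where

  infixl 7 _∙_

  _∙_ : Mat N → Mat N → Mat N
  _∙_ = _·_ N

  lift : Mat N → ℕMat
  lift (mat a b c d) = nmat (toℕ a) (toℕ b) (toℕ c) (toℕ d)

  pow : Mat N → ℕ → Mat N
  pow A zero    = idM N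
  pow A (suc k) = A ∙ pow A k

  private
    toℕ-+ₘ : ∀ x y → toℕ ((toℕ (x mod N) + toℕ (y mod N)) mod N) ≡ x + y [mod N ]
    toℕ-+ₘ x y = mod-trans (toℕ-mod _ N) (mod-+ (toℕ-mod x N) (toℕ-mod y N))

  lift-∙ : ∀ A B → lift (A ∙ B) ≈ lift A *ᴹ lift B [mod N ]
  lift-∙ (mat a b c d) (mat a' b' c' d') = toℕ-+ₘ _ _ , toℕ-+ₘ _ _ , toℕ-+ₘ _ _ , toℕ-+ₘ _ _

  lift-injective : ∀ {A B} → lift A ≈ lift B [mod N ] → A ≡ B
  lift-injective {mat a b c d} {mat a' b' c' d'} (ea , eb , ec , ed) =
    mat-cong (entry ea) (entry eb) (entry ec) (entry ed)
    where
    mat-cong : ∀ {x y z w x' y' z' w'} → x ≡ x' → y ≡ y' → z ≡ z' → w ≡ w' → mat x y z w ≡ mat x' y' z' w'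
    mat-cong refl refl refl refl = refl
    entry : ∀ {x y : Fin N} → toℕ x ≡ toℕ y [mod N ] → x ≡ y
    entry {x} {y} e = toℕ-injective (mod⇒≡ (toℕ<n x) (toℕ<n y) e)

  ∙-assoc : ∀ A B C → (A ∙ B) ∙ C ≡ A ∙ (B ∙ C)
  ∙-assoc A B C = lift-injective (begin
    lift ((A ∙ B) ∙ C)               ≈⟨ lift-∙ (A ∙ B) C ⟩
    lift (A ∙ B) *ᴹ lift C           ≈⟨ *ᴹ-cong (lift-∙ A B) (≈-refl {X = lift C}) ⟩
    lift A *ᴹ lift B *ᴹ lift C       ≡⟨ *ᴹ-assoc (lift A) (lift B) (lift C) ⟩
    lift A *ᴹ (lift B *ᴹ lift C)     ≈⟨ *ᴹ-cong (≈-refl {X = lift A}) (lift-∙ B C) ⟨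
    lift A *ᴹ lift (B ∙ C)           ≈⟨ lift-∙ A (B ∙ C) ⟨
    lift (A ∙ (B ∙ C))               ∎)
    where open ≈-Reasoning N

  lift-det : ∀ A → det N A ≡ 1ₘ N → Det≡1[mod N ] (lift A)
  lift-det (mat a b c d) det≡1 = begin
    toℕ a * toℕ d         ≈⟨ toℕ-mod _ N ⟨
    U                     ≈⟨ mod-+-multiple U 1 ⟨
    U + 1 * N             ≡⟨ cong (U +_) (trans (*-identityˡ N) (sym (m∸n+n≡m (<⇒≤ (toℕ<n (_*ₘ_ N b c)))))) ⟩
    U + ((N ∸ V) + V)     ≡⟨ +-assoc U (N ∸ V) V ⟨
    U + (N ∸ V) + V       ≈⟨ mod-+ U+[N∸V]≡1 mod-refl ⟩
    1 + V                 ≈⟨ mod-+ mod-refl (toℕ-mod _ N) ⟩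
    1 + toℕ b * toℕ c     ∎
    where
    open ≡-mod-Reasoning N
    U V : ℕ
    U = toℕ (_*ₘ_ N a d)
    V = toℕ (_*ₘ_ N b c)
    U+[N∸V]≡1 : U + (N ∸ V) ≡ 1 [mod N ]
    U+[N∸V]≡1 = mod-trans (mod-sym (toℕ-mod _ N)) (mod-trans (mod-reflexive (cong toℕ det≡1)) (toℕ-mod 1 N))

  module _ (1<N : 1 < N) where

    lift-idM : lift (idM N) ≡ 1ᴹ
    lift-idM = nmat-cong (entry 1<N) (entry 0<N) (entry 0<N) (entry 1<N)
      where
      0<N : 0 < N
      0<N = <-trans z<s 1<N
      entry : ∀ {x} → x < N → toℕ (x mod N) ≡ x
      entry x<N = trans (toℕ-fromℕ< _) (m<n⇒m%n≡m x<N)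

    ∙-identityˡ : ∀ A → idM N ∙ A ≡ A
    ∙-identityˡ A = lift-injective (begin
      lift (idM N ∙ A)        ≈⟨ lift-∙ (idM N) A ⟩
      lift (idM N) *ᴹ lift A  ≡⟨ cong (_*ᴹ lift A) lift-idM ⟩
      1ᴹ *ᴹ lift A            ≡⟨ *ᴹ-identityˡ (lift A) ⟩
      lift A                  ∎)
      where open ≈-Reasoning N

    lift-pow : ∀ A k → lift (pow A k) ≈ lift A ^ᴹ k [mod N ]
    lift-pow A zero    = ≈-reflexive lift-idM
    lift-pow A (suc k) = ≈-trans (lift-∙ A (pow A k)) (*ᴹ-cong (≈-refl {X = lift A}) (lift-pow A k))

    ∙-cancelˡ : ∀ {R R' A B} → R ∙ R' ≡ idM N → R' ∙ A ≡ R' ∙ B → A ≡ B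
    ∙-cancelˡ {R} {R'} {A} {B} RR'≡1 R'A≡R'B = begin
      A                 ≡⟨ ∙-identityˡ A ⟨
      idM N ∙ A         ≡⟨ cong (_∙ A) RR'≡1 ⟨
      (R ∙ R') ∙ A      ≡⟨ ∙-assoc R R' A ⟩
      R ∙ (R' ∙ A)      ≡⟨ cong (R ∙_) R'A≡R'B ⟩
      R ∙ (R' ∙ B)      ≡⟨ ∙-assoc R R' B ⟨
      (R ∙ R') ∙ B      ≡⟨ cong (_∙ B) RR'≡1 ⟩
      idM N ∙ B         ≡⟨ ∙-identityˡ B ⟩
      B                 ∎
      where open ≡-Reasoning

-- The congruence filtration of SL₂(ℤ/pⁿℤ)

module Levels (p : ℕ) .{{_ : NonZero p}} (1<p : 1 < p) (n : ℕ) (1<pⁿ : 1 < p ^ n) where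

  instance
    pⁿ≢0 : NonZero (p ^ n)
    pⁿ≢0 = m^n≢0 p n

  open Lift (p ^ n)

  InKer : ℕ → Mat (p ^ n) → Set
  InKer k A = lift A ≈ 1ᴹ [mod p ^ k ]

  -- A ≡ 1 + pⁱX (mod pⁱ⁺¹): X mod p is the image of A in (1 + pⁱM₂)/(1 + pⁱ⁺¹M₂) ≅ M₂(𝔽_p).
  HasClass : ℕ → Mat (p ^ n) → ℕMat → Set
  HasClass i A X = lift A ≈ 1ᴹ +ᴹ p ^ i • X [mod p ^ suc i ]

  class : ℕ → Mat (p ^ n) → ℕMat
  class i A = lift A /ᴹ p ^ i
    where instance _ = m^n≢0 p i

  lift-∙-mod : ∀ {k} → k ≤ n → ∀ A B → lift (A ∙ B) ≈ lift A *ᴹ lift B [mod p ^ k ]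
  lift-∙-mod k≤n A B = ≈-∣ (^-monoʳ-∣ p k≤n) (lift-∙ A B)

  HasClass-unique : ∀ {i A X Y} → HasClass i A X → HasClass i A Y → X ≈ Y [mod p ]
  HasClass-unique {i} {A} {X} {Y} hX hY = •-cancelˡ X Y {{m^n≢0 p i}} (+ᴹ-cancelˡ 1ᴹ (≈-trans (≈-sym hX) hY))

  HasClass-resp : ∀ {i A X Y} → HasClass i A X → X ≈ Y [mod p ] → HasClass i A Y
  HasClass-resp {i} hX X≈Y = ≈-trans hX (+ᴹ-cong (≈-refl {X = 1ᴹ}) (•-scale (p ^ i) X≈Y))

  HasClass⇒InKer : ∀ {i A X} → HasClass i A X → InKer i A
  HasClass⇒InKer {i} {A} {X} hX = ≈-trans (≈-∣ (n∣m*n p) hX) (+ᴹ-∣ 1ᴹ ∣-refl X)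

  HasClass-0⇒InKer : ∀ {i A X} → HasClass i A X → X ≈ 0ᴹ [mod p ] → InKer (suc i) A
  HasClass-0⇒InKer {i} {A} hX X≈0 =
    subst (λ Z → lift A ≈ Z [mod p ^ suc i ]) (cong (1ᴹ +ᴹ_) (•-zeroʳ (p ^ i))) (HasClass-resp {i} hX X≈0)

  InKer⇒≡ : ∀ {j A} → InKer (suc j) A → lift A ≡ 1ᴹ +ᴹ p ^ suc j • class (suc j) A
  InKer⇒≡ {j} {A} = ≈1ᴹ⇒≡1ᴹ+m•[X/m] {{m^n≢0 p (suc j)}} (^-monoʳ-< p 1<p {0} {suc j} z<s) (lift A)

  InKer⇒HasClass : ∀ {j A} → InKer (suc j) A → HasClass (suc j) A (class (suc j) A)
  InKer⇒HasClass {j} kA = ≈-reflexive (InKer⇒≡ {j} kA)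

  HasClass-idM : ∀ i → HasClass i (idM (p ^ n)) 0ᴹ
  HasClass-idM i = ≈-reflexive (trans (lift-idM 1<pⁿ) (cong (1ᴹ +ᴹ_) (sym (•-zeroʳ (p ^ i)))))

  HasClass-∙ : ∀ {j A B X Y} → suc (suc j) ≤ n →
    HasClass (suc j) A X → HasClass (suc j) B Y → HasClass (suc j) (A ∙ B) (X +ᴹ Y)
  HasClass-∙ {j} {A} {B} {X} {Y} le hX hY = begin
    lift (A ∙ B)                               ≈⟨ lift-∙-mod le A B ⟩
    lift A *ᴹ lift B                           ≈⟨ *ᴹ-cong hX hY ⟩
    (1ᴹ +ᴹ u • X) *ᴹ (1ᴹ +ᴹ u • Y)             ≡⟨ [1+uX][1+uY] u X Y ⟩
    1ᴹ +ᴹ u • (X +ᴹ Y) +ᴹ (u * u) • (X *ᴹ Y)   ≈⟨ +ᴹ-∣ _ (*-monoˡ-∣ {p} u (m∣m*n {p} (p ^ j))) (X *ᴹ Y) ⟩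
    1ᴹ +ᴹ u • (X +ᴹ Y)                         ∎
    where
    u : ℕ
    u = p ^ suc j
    open ≈-Reasoning (p * u)

  InKer-inverse : ∀ {k A B} → k ≤ n → A ∙ B ≡ idM (p ^ n) → InKer k A → InKer k B
  InKer-inverse {k} {A} {B} k≤n AB≡1 kA = begin
    lift B              ≡⟨ *ᴹ-identityˡ (lift B) ⟨
    1ᴹ *ᴹ lift B        ≈⟨ *ᴹ-cong kA (≈-refl {X = lift B}) ⟨
    lift A *ᴹ lift B    ≈⟨ lift-∙-mod k≤n A B ⟨
    lift (A ∙ B)        ≡⟨ cong lift AB≡1 ⟩
    lift (idM (p ^ n))  ≡⟨ lift-idM 1<pⁿ ⟩
    1ᴹ                  ∎
    where open ≈-Reasoning (p ^ k)

  HasClass-inverse : ∀ {j A B X Y} → suc (suc j) ≤ n → A ∙ B ≡ idM (p ^ n) →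
    HasClass (suc j) A X → HasClass (suc j) B Y → X +ᴹ Y ≈ 0ᴹ [mod p ]
  HasClass-inverse {j} {X = X} {Y} le AB≡1 hX hY =
    HasClass-unique {suc j} (subst (λ M → HasClass (suc j) M (X +ᴹ Y)) AB≡1 (HasClass-∙ {j} le hX hY)) (HasClass-idM (suc j))

  HasClass-pow : ∀ {j A X} → suc (suc j) ≤ n → HasClass (suc j) A X → ∀ e → HasClass (suc j) (pow A e) (e • X)
  HasClass-pow {j} le hX zero    = HasClass-idM (suc j)
  HasClass-pow {j} le hX (suc e) = HasClass-∙ le hX (HasClass-pow le hX e)

  HasClass-trace : ∀ {j A X} → suc (suc j) ≤ n → det (p ^ n) A ≡ 1ₘ (p ^ n) →
    HasClass (suc j) A X → trace X ≡ 0 [mod p ]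
  HasClass-trace {j} {A} {X} le det≡1 hX = Det≡1⇒trace≡0 {{m^n≢0 p (suc j)}} X (m∣m*n (p ^ j))
    (Det≡1-resp-≈ hX (mod-∣ (^-monoʳ-∣ p le) (lift-det A det≡1)))

  HasClass-pow-p : ∀ {j A X} → suc (suc (suc j)) ≤ n → Prime p → (p ≡ 2 → 1 ≤ j) →
    HasClass (suc j) A X → HasClass (suc (suc j)) (pow A p) X
  HasClass-pow-p {j} {A} {X} le pr parity hX =
    HasClass-resp {suc (suc j)} expansion (HasClass-unique {suc j} (InKer⇒HasClass {j} kA) hX)
    where
    kA : InKer (suc j) A
    kA = HasClass⇒InKer {suc j} hX
    u : ℕ
    u = p ^ suc j
    Y : ℕMat
    Y = class (suc j) A
    p^[3+j]∣u³ : p ^ (3 + j) ∣ u * u * u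
    p^[3+j]∣u³ = divides (p ^ j * p ^ j) (regroup (p ^ j))
      where
      regroup : ∀ P → p * P * (p * P) * (p * P) ≡ P * P * (p * (p * (p * P)))
      regroup P = solve (p ∷ P ∷ [])
    open ≈-Reasoning (p ^ (3 + j))
    expansion : HasClass (suc (suc j)) (pow A p) Y
    expansion = begin
      lift (pow A p)                                        ≈⟨ ≈-∣ (^-monoʳ-∣ p le) (lift-pow 1<pⁿ A p) ⟩
      lift A ^ᴹ p                                           ≡⟨ cong (_^ᴹ p) (InKer⇒≡ {j} kA) ⟩
      (1ᴹ +ᴹ u • Y) ^ᴹ p                                    ≈⟨ ≈-∣ p^[3+j]∣u³ ([1+uX]^k u Y p) ⟩
      1ᴹ +ᴹ (p * u) • Y +ᴹ ((p C 2) * (u * u)) • (Y *ᴹ Y)   ≈⟨ +ᴹ-∣ _ (p^[3+j]∣pC2*p^[1+j]² j pr parity) (Y *ᴹ Y) ⟩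
      1ᴹ +ᴹ (p * u) • Y                                     ∎

module _ {A : Set} where

  lookup-injective : ∀ {xs : List A} → Unique xs → ∀ {i j} → lookup xs i ≡ lookup xs j → i ≡ j
  lookup-injective (_  ∷ _) {Fin.zero}  {Fin.zero}  _ = refl
  lookup-injective (x∉ ∷ _) {Fin.zero}  {Fin.suc j} e = ⊥-elim (All.lookup x∉ (∈-lookup j) e)
  lookup-injective (x∉ ∷ _) {Fin.suc i} {Fin.zero}  e = ⊥-elim (All.lookup x∉ (∈-lookup i) (sym e))
  lookup-injective (_  ∷ u) {Fin.suc i} {Fin.suc j} e = cong Fin.suc (lookup-injective u e)

length-≤-injection : ∀ {A B : Set} {xs : List A} {ys : List B} (f : A → B) → Unique xs →
  (∀ {x} → x ∈ xs → f x ∈ ys) → (∀ {x y} → x ∈ xs → y ∈ xs → f x ≡ f y → x ≡ y) →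
  length xs ≤ length ys
length-≤-injection {xs = xs} {ys} f u f∈ f-inj = injective⇒≤ {f = g} g-injective
  where
  g : Fin (length xs) → Fin (length ys)
  g i = index (f∈ (∈-lookup i))
  g-injective : ∀ {i j} → g i ≡ g j → i ≡ j
  g-injective {i} {j} gi≡gj = lookup-injective u (f-inj (∈-lookup i) (∈-lookup j) (begin
    f (lookup xs i)               ≡⟨ lookup-index (f∈ (∈-lookup i)) ⟩
    lookup ys (g i)               ≡⟨ cong (lookup ys) gi≡gj ⟩
    lookup ys (g j)               ≡⟨ lookup-index (f∈ (∈-lookup j)) ⟨
    f (lookup xs j)               ∎))
    where open ≡-Reasoning

module _ {A B : Set} where

  length-cartesianProduct : ∀ (xs : List A) (ys : List B) →
    length (cartesianProduct xs ys) ≡ length xs * length ys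
  length-cartesianProduct []       ys = refl
  length-cartesianProduct (x ∷ xs) ys = trans (length-++ (map (x ,_) ys))
    (cong₂ _+_ (length-map (x ,_) ys) (length-cartesianProduct xs ys))

  map-cartesianProduct : ∀ {C : Set} (h : A × B → C) xs ys →
    map h (cartesianProduct xs ys) ≡ concatMap (λ x → map (λ y → h (x , y)) ys) xs
  map-cartesianProduct h []       ys = refl
  map-cartesianProduct h (x ∷ xs) ys = trans (map-++ h (map (x ,_) ys) _)
    (cong₂ _++_ (sym (map-∘ ys)) (map-cartesianProduct h xs ys))

map≡concatMap-singleton : ∀ {A B : Set} (g : A → B) xs → map g xs ≡ concatMap (λ x → [ g x ]) xs
map≡concatMap-singleton g []       = refl
map≡concatMap-singleton g (x ∷ xs) = cong (g x ∷_) (map≡concatMap-singleton g xs)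

module AllMats (N : ℕ) .{{_ : NonZero N}} where

  F : List (Fin N)
  F = allFin N

  Fin⁴ : Set
  Fin⁴ = Fin N × Fin N × Fin N × Fin N

  fromFin⁴ : Fin⁴ → Mat N
  fromFin⁴ (a , b , c , d) = mat a b c d

  allMats≡map-fromFin⁴ : allMats N ≡ map fromFin⁴ (cartesianProduct F (cartesianProduct F (cartesianProduct F F)))
  allMats≡map-fromFin⁴ = sym (trans (map-cartesianProduct fromFin⁴ F _)
    (concatMap-cong (λ a → trans (map-cartesianProduct _ F _)
      (concatMap-cong (λ b → trans (map-cartesianProduct _ F F)
        (concatMap-cong (λ c → map≡concatMap-singleton (mat a b c) F) F)) F)) F))

  fromFin⁴-injective : ∀ {q r} → fromFin⁴ q ≡ fromFin⁴ r → q ≡ r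
  fromFin⁴-injective {_ , _ , _ , _} {_ , _ , _ , _} refl = refl

  allMats-unique : Unique (allMats N)
  allMats-unique = subst Unique (sym allMats≡map-fromFin⁴) (map⁺ fromFin⁴-injective
    (cartesianProduct⁺ (allFin⁺ N) (cartesianProduct⁺ (allFin⁺ N) (cartesianProduct⁺ (allFin⁺ N) (allFin⁺ N)))))

  ∈-allMats : ∀ A → A ∈ allMats N
  ∈-allMats (mat a b c d) = subst (mat a b c d ∈_) (sym allMats≡map-fromFin⁴) (∈-map⁺ fromFin⁴
    (∈-cartesianProduct⁺ (∈-allFin a) (∈-cartesianProduct⁺ (∈-allFin b) (∈-cartesianProduct⁺ (∈-allFin c) (∈-allFin d)))))

-- Coordinates on sl₂(𝔽_p)

module Coordinates (p : ℕ) .{{_ : NonZero p}} where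

  Triple : Set
  Triple = Fin p × Fin p × Fin p

  _≟ᵗ_ : DecidableEquality Triple
  _≟ᵗ_ = ≡-dec _≟ᶠ_ (≡-dec _≟ᶠ_ _≟ᶠ_)

  allTriples : List Triple
  allTriples = cartesianProduct (allFin p) (cartesianProduct (allFin p) (allFin p))

  length-allTriples : length allTriples ≡ p * (p * p)
  length-allTriples = trans (length-cartesianProduct (allFin p) _) (cong₂ _*_ (length-tabulate {n = p} id)
    (trans (length-cartesianProduct (allFin p) (allFin p)) (cong₂ _*_ (length-tabulate {n = p} id) (length-tabulate {n = p} id))))

  -- For traceless X the entries a, b, c determine X mod p.
  coords : ℕMat → Triple
  coords (nmat a b c _) = a mod p , b mod p , c mod p

  fromTriple : Triple → ℕMat
  fromTriple (a , b , c) = nmat (toℕ a) (toℕ b) (toℕ c) (p ∸ toℕ a)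

  coords-resp : ∀ {X Y} → X ≈ Y [mod p ] → coords X ≡ coords Y
  coords-resp (ea , eb , ec , _) = cong₂ _,_ (mod⇒mod≡ ea) (cong₂ _,_ (mod⇒mod≡ eb) (mod⇒mod≡ ec))

  coords-injective : ∀ {X Y} → trace X ≡ 0 [mod p ] → trace Y ≡ 0 [mod p ] → coords X ≡ coords Y → X ≈ Y [mod p ]
  coords-injective {nmat a b c d} {nmat a' b' c' d'} trX trY e =
    ea , mod≡⇒mod (cong (proj₁ ∘ proj₂) e) , mod≡⇒mod (cong (proj₂ ∘ proj₂) e) ,
    mod-+-cancelˡ a (mod-trans trX (mod-trans (mod-sym trY) (mod-+ (mod-sym ea) mod-refl)))
    where
    ea : a ≡ a' [mod p ]
    ea = mod≡⇒mod (cong proj₁ e)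

  trace-fromTriple : ∀ v → trace (fromTriple v) ≡ 0 [mod p ]
  trace-fromTriple (a , _ , _) = mod-trans (mod-reflexive (m+[n∸m]≡n (<⇒≤ (toℕ<n a)))) (0 , 1 , refl)

  coords-fromTriple : ∀ v → coords (fromTriple v) ≡ v
  coords-fromTriple (a , b , c) = cong₂ _,_ (entry a) (cong₂ _,_ (entry b) (entry c))
    where
    entry : ∀ (x : Fin p) → toℕ x mod p ≡ x
    entry x = toℕ-injective (mod⇒≡ (toℕ<n _) (toℕ<n x) (toℕ-mod (toℕ x) p))

-- Slim subgroups

open Equivalence using (to; from)

module Subgroup (p : ℕ) .{{_ : NonZero p}} (pr : Prime p) (m : ℕ) where

  n : ℕ
  n = suc (suc m)

  1<p : 1 < p
  1<p = nonTrivial⇒n>1 p {{prime⇒nonTrivial pr}}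

  1<pⁿ : 1 < p ^ n
  1<pⁿ = ^-monoʳ-< p 1<p {0} {n} z<s

  open Levels p 1<p n 1<pⁿ
  open Lift (p ^ n)

  T-inKer⇔InKer : ∀ k A → T (inKer p n k A) ⇔ InKer k A
  T-inKer⇔InKer k (mat a b c d) = mk⇔
    (λ t → let ta , t′ = to T-∧ t ; tb , t″ = to T-∧ t′ ; tc , td = to T-∧ t″
           in entry⁻ ta , entry⁻ tb , entry⁻ tc , entry⁻ td)
    (λ (ea , eb , ec , ed) → from T-∧ (entry⁺ ea , from T-∧ (entry⁺ eb , from T-∧ (entry⁺ ec , entry⁺ ed))))
    where
    instance _ = m^n≢0 p k
    entry⁻ : ∀ {x y} → T (x % p ^ k ≡ᵇ y % p ^ k) → x ≡ y [mod p ^ k ]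
    entry⁻ t = %≡⇒mod (≡ᵇ⇒≡ _ _ t)
    entry⁺ : ∀ {x y} → x ≡ y [mod p ^ k ] → T (x % p ^ k ≡ᵇ y % p ^ k)
    entry⁺ e = ≡⇒≡ᵇ _ _ (mod⇒%≡ e)

  module _ (H : Mat (p ^ n) → Bool) (sub : IsSubgroupSL₂ (p ^ n) H) where

    open IsSubgroupSL₂ sub

    InH : ℕ → Mat (p ^ n) → Set
    InH k A = H A ≡ true × InKer k A

    T-Hk⇔InH : ∀ k A → T (Hk p n H k A) ⇔ InH k A
    T-Hk⇔InH k A = mk⇔
      (λ t → let tH , tK = to T-∧ t in to T-≡ tH , to (T-inKer⇔InKer k A) tK)
      (λ (A∈H , kA) → from T-∧ (from T-≡ A∈H , from (T-inKer⇔InKer k A) kA))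

    Hlist : ℕ → List (Mat (p ^ n))
    Hlist k = filterᵇ (Hk p n H k) (allMats (p ^ n))

    ∈-Hlist⁻ : ∀ k {A} → A ∈ Hlist k → InH k A
    ∈-Hlist⁻ k {A} A∈ = to (T-Hk⇔InH k A) (proj₂ (∈-filter⁻ (T? ∘ Hk p n H k) {xs = allMats (p ^ n)} A∈))

    ∈-Hlist⁺ : ∀ k {A} → InH k A → A ∈ Hlist k
    ∈-Hlist⁺ k {A} A∈H = ∈-filter⁺ (T? ∘ Hk p n H k) (AllMats.∈-allMats (p ^ n) A) (from (T-Hk⇔InH k A) A∈H)

    Hlist-unique : ∀ k → Unique (Hlist k)
    Hlist-unique k = filter⁺ (T? ∘ Hk p n H k) (AllMats.allMats-unique (p ^ n))

    pow-∈H : ∀ {A} → H A ≡ true → ∀ k → H (pow A k) ≡ true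
    pow-∈H A∈H zero    = has-id
    pow-∈H A∈H (suc k) = closed· _ _ A∈H (pow-∈H A∈H k)

    Realised : ℕ → ℕMat → Set
    Realised i X = ∃[ A ] InH i A × HasClass i A X

    Full : ℕ → Set
    Full i = ∀ X → trace X ≡ 0 [mod p ] → Realised i X

    Full-suc : ∀ {j} → suc (suc (suc j)) ≤ n → (p ≡ 2 → 1 ≤ j) → Full (suc j) → Full (suc (suc j))
    Full-suc {j} le parity full X trX with full X trX
    ... | A , (A∈H , _) , hA = pow A p , (pow-∈H A∈H p , HasClass⇒InKer {suc (suc j)} hAᵖ) , hAᵖ
      where
      hAᵖ : HasClass (suc (suc j)) (pow A p) X
      hAᵖ = HasClass-pow-p le pr parity hA

    Full-propagate : ∀ {j k} → j ≤′ k → k ≤ m → (p ≡ 2 → 1 ≤ j) → Full (suc j) → Full (suc k)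
    Full-propagate ≤′-refl            _   _      full = full
    Full-propagate (≤′-step j≤′k) k<m parity full =
      Full-suc (s≤s (s≤s k<m)) (λ p≡2 → ≤-trans (parity p≡2) (≤′⇒≤ j≤′k))
        (Full-propagate j≤′k (<⇒≤ k<m) parity full)

    Full⇒¬Slim : Full (suc m) → ¬ Slim p n H
    Full⇒¬Slim full slim = slim contains
      where
      contains : ∀ A → det (p ^ n) A ≡ 1ₘ (p ^ n) → inKer p n (n ∸ 1) A ≡ true → H A ≡ true
      contains A det≡1 A∈K = same-class (full _ (HasClass-trace ≤-refl det≡1 hA))
        where
        hA : HasClass (suc m) A (class (suc m) A)
        hA = InKer⇒HasClass {m} (to (T-inKer⇔InKer (suc m) A) (from T-≡ A∈K))
        same-class : Realised (suc m) (class (suc m) A) → H A ≡ true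
        same-class (B , (B∈H , _) , hB) = subst (λ C → H C ≡ true) (lift-injective (≈-trans hB (≈-sym hA))) B∈H

    Slim⇒¬Full : Slim p n H → ∀ {j} → j ≤ m → (p ≡ 2 → 1 ≤ j) → ¬ Full (suc j)
    Slim⇒¬Full slim j≤m parity full = Full⇒¬Slim (Full-propagate (≤⇒≤′ j≤m) ≤-refl parity full) slim

    Realised-resp : ∀ {i X Y} → Realised i X → X ≈ Y [mod p ] → Realised i Y
    Realised-resp {i} (A , A∈H , hA) X≈Y = A , A∈H , HasClass-resp {i} hA X≈Y

    module _ {j} (le : suc (suc j) ≤ n) where

      Realised-scale : ∀ {X} → Realised (suc j) X → ∀ e → Realised (suc j) (e • X)
      Realised-scale {X} (A , (A∈H , _) , hA) e = pow A e , (pow-∈H A∈H e , HasClass⇒InKer {suc j} hAᵉ) , hAᵉ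
        where
        hAᵉ : HasClass (suc j) (pow A e) (e • X)
        hAᵉ = HasClass-pow le hA e

      Realised-unscale : ∀ {d V} .{{_ : NonZero d}} → d < p → Realised (suc j) (d • V) → Realised (suc j) V
      Realised-unscale {d} {V} d<p dV with inverse-mod pr d<p
      ... | e , ed≡1 = Realised-resp {suc j} (Realised-scale dV e) (begin
        e • (d • V)   ≡⟨ •-assoc e d V ⟩
        (e * d) • V   ≈⟨ •-congʳ V ed≡1 ⟩
        1 • V         ≡⟨ •-identityˡ V ⟩
        V             ∎)
        where open ≈-Reasoning p

      Realised-difference : ∀ {X X' W} → Realised (suc j) X → Realised (suc j) X' →
        X ≈ X' +ᴹ W [mod p ] → Realised (suc j) W
      Realised-difference {X} {X'} {W} (A , (A∈H , _) , hA) (A' , (A'∈H , kA') , hA') X≈X'+W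
        with closed⁻¹ A' A'∈H
      ... | B , B∈H , A'B≡1 , _ = A ∙ B , (closed· A B A∈H B∈H , HasClass⇒InKer {suc j} hAB) , hAB′
        where
        Y : ℕMat
        Y = class (suc j) B
        hB : HasClass (suc j) B Y
        hB = InKer⇒HasClass {j} (InKer-inverse (<⇒≤ le) A'B≡1 kA')
        hAB : HasClass (suc j) (A ∙ B) (X +ᴹ Y)
        hAB = HasClass-∙ le hA hB
        hAB′ : HasClass (suc j) (A ∙ B) W
        hAB′ = HasClass-resp {suc j} hAB (begin
          X +ᴹ Y            ≈⟨ +ᴹ-cong X≈X'+W (≈-refl {X = Y}) ⟩
          X' +ᴹ W +ᴹ Y      ≡⟨ cong (_+ᴹ Y) (+ᴹ-comm X' W) ⟩
          W +ᴹ X' +ᴹ Y      ≡⟨ +ᴹ-assoc W X' Y ⟩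
          W +ᴹ (X' +ᴹ Y)    ≈⟨ +ᴹ-cong (≈-refl {X = W}) (HasClass-inverse le A'B≡1 hA' hB) ⟩
          W +ᴹ 0ᴹ           ≡⟨ +ᴹ-identityʳ W ⟩
          W                 ∎)
          where open ≈-Reasoning p

    same-class⇒quotient-InH : ∀ {j R B A} → suc (suc j) ≤ n → InH (suc j) R → InH (suc j) A →
      class (suc j) R ≈ class (suc j) A [mod p ] → R ∙ B ≡ idM (p ^ n) → H B ≡ true →
      InH (suc (suc j)) (B ∙ A)
    same-class⇒quotient-InH {j} {R} {B} {A} le (_ , kR) (A∈H , kA) XR≈XA RB≡1 B∈H =
      closed· B A B∈H A∈H , HasClass-0⇒InKer {suc j} (HasClass-∙ le hB hA) (begin
        Y +ᴹ XA   ≈⟨ +ᴹ-cong (≈-refl {X = Y}) (≈-sym XR≈XA) ⟩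
        Y +ᴹ XR   ≡⟨ +ᴹ-comm Y XR ⟩
        XR +ᴹ Y   ≈⟨ HasClass-inverse le RB≡1 (InKer⇒HasClass {j} kR) hB ⟩
        0ᴹ        ∎)
      where
      open ≈-Reasoning p
      XR XA Y : ℕMat
      XR = class (suc j) R
      XA = class (suc j) A
      Y = class (suc j) B
      hA : HasClass (suc j) A XA
      hA = InKer⇒HasClass {j} kA
      hB : HasClass (suc j) B Y
      hB = InKer⇒HasClass {j} (InKer-inverse (<⇒≤ le) RB≡1 kR)

    module Count {j : ℕ} (le : suc (suc j) ≤ n) where

      open Coordinates p

      H₁ H₂ : List (Mat (p ^ n))
      H₁ = Hlist (suc j)
      H₂ = Hlist (suc (suc j))

      coordsOf : Mat (p ^ n) → Triple
      coordsOf A = coords (class (suc j) A)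

      hasClass : ∀ {A} → A ∈ H₁ → HasClass (suc j) A (class (suc j) A)
      hasClass A∈ = InKer⇒HasClass {j} (proj₂ (∈-Hlist⁻ (suc j) A∈))

      realised : ∀ {A} → A ∈ H₁ → Realised (suc j) (class (suc j) A)
      realised {A} A∈ = A , ∈-Hlist⁻ (suc j) A∈ , hasClass A∈

      traceless : ∀ {A} → A ∈ H₁ → trace (class (suc j) A) ≡ 0 [mod p ]
      traceless {A} A∈ = HasClass-trace le (⊆SL₂ A (proj₁ (∈-Hlist⁻ (suc j) A∈))) (hasClass A∈)

      -- An element of H₁ with coordinates w; the junk value idM when there is none.
      representative : Triple → ∃[ R ] H R ≡ true
      representative w with any? (λ A → coordsOf A ≟ᵗ w) H₁
      ... | yes hit = proj₁ (find hit) , proj₁ (∈-Hlist⁻ (suc j) (proj₁ (proj₂ (find hit))))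
      ... | no _    = idM (p ^ n) , has-id

      representative-spec : ∀ {A} → A ∈ H₁ →
        let R = proj₁ (representative (coordsOf A)) in R ∈ H₁ × coordsOf R ≡ coordsOf A
      representative-spec {A} A∈ with any? (λ B → coordsOf B ≟ᵗ coordsOf A) H₁
      ... | yes hit = proj₂ (find hit)
      ... | no miss = ⊥-elim (miss (lose A∈ refl))

      R⁻¹ : Triple → Mat (p ^ n)
      R⁻¹ w = proj₁ (closed⁻¹ _ (proj₂ (representative w)))

      R⁻¹∈H : ∀ w → H (R⁻¹ w) ≡ true
      R⁻¹∈H w = proj₁ (proj₂ (closed⁻¹ _ (proj₂ (representative w))))

      RR⁻¹≡1 : ∀ w → proj₁ (representative w) ∙ R⁻¹ w ≡ idM (p ^ n)
      RR⁻¹≡1 w = proj₁ (proj₂ (proj₂ (closed⁻¹ _ (proj₂ (representative w)))))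

      R⁻¹-cancel : ∀ w {A A'} → R⁻¹ w ∙ A ≡ R⁻¹ w ∙ A' → A ≡ A'
      R⁻¹-cancel w = ∙-cancelˡ 1<pⁿ {proj₁ (representative w)} (RR⁻¹≡1 w)

      R⁻¹A∈H₂ : ∀ {A} → A ∈ H₁ → R⁻¹ (coordsOf A) ∙ A ∈ H₂
      R⁻¹A∈H₂ {A} A∈ = ∈-Hlist⁺ (suc (suc j)) (same-class⇒quotient-InH le
        (∈-Hlist⁻ (suc j) R∈) (∈-Hlist⁻ (suc j) A∈) (coords-injective (traceless R∈) (traceless A∈) coordsR≡coordsA)
        (RR⁻¹≡1 (coordsOf A)) (R⁻¹∈H (coordsOf A)))
        where
        R : Mat (p ^ n)
        R = proj₁ (representative (coordsOf A))
        R∈ : R ∈ H₁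
        R∈ = proj₁ (representative-spec A∈)
        coordsR≡coordsA : coordsOf R ≡ coordsOf A
        coordsR≡coordsA = proj₂ (representative-spec A∈)

      module _ (v : Triple) (v∉ : ¬ Any (λ A → coordsOf A ≡ v) H₁) where

        V : ℕMat
        V = fromTriple v

        shifted : Mat (p ^ n) → ℕ → Triple
        shifted A k = coords (class (suc j) A +ᴹ k • V)

        shifted-traceless : ∀ {A} → A ∈ H₁ → ∀ k → trace (class (suc j) A +ᴹ k • V) ≡ 0 [mod p ]
        shifted-traceless {A} A∈ k = begin
          trace (X +ᴹ k • V)         ≡⟨ trace-+ᴹ X (k • V) ⟩
          trace X + trace (k • V)    ≡⟨ cong (trace X +_) (trace-• k V) ⟩
          trace X + k * trace V      ≈⟨ mod-+ (traceless A∈) (mod-* (mod-refl {x = k}) (trace-fromTriple v)) ⟩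
          k * 0                      ≡⟨ *-zeroʳ k ⟩
          0                          ∎
          where
          open ≡-mod-Reasoning p
          X : ℕMat
          X = class (suc j) A

        V-unrealised : ¬ Realised (suc j) V
        V-unrealised (A , A∈H , hA) = v∉ (lose (∈-Hlist⁺ (suc j) A∈H)
          (trans (coords-resp (HasClass-unique {suc j} (InKer⇒HasClass {j} (proj₂ A∈H)) hA)) (coords-fromTriple v)))

        no-collision : ∀ {A A' k k'} → A ∈ H₁ → A' ∈ H₁ → k < k' → k' < p → shifted A k ≢ shifted A' k'
        no-collision {A} {A'} {k} {k'} A∈ A'∈ k<k' k'<p e =
          V-unrealised (Realised-unscale le d<p (Realised-difference le (realised A∈) (realised A'∈) X≈X'+dV))
          where
          d : ℕ
          d = k' ∸ k
          instance _ = >-nonZero (m<n⇒0<n∸m k<k')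
          d<p : d < p
          d<p = ≤-<-trans (m∸n≤m k' k) k'<p
          X X' : ℕMat
          X = class (suc j) A
          X' = class (suc j) A'
          X≈X'+dV : X ≈ X' +ᴹ d • V [mod p ]
          X≈X'+dV = +ᴹ-cancelʳ (k • V) (begin
            X +ᴹ k • V                ≈⟨ coords-injective (shifted-traceless A∈ k) (shifted-traceless A'∈ k') e ⟩
            X' +ᴹ k' • V              ≡⟨ cong (λ i → X' +ᴹ i • V) (m∸n+n≡m (<⇒≤ k<k')) ⟨
            X' +ᴹ (d + k) • V         ≡⟨ cong (X' +ᴹ_) (•-distribʳ d k V) ⟩
            X' +ᴹ (d • V +ᴹ k • V)    ≡⟨ +ᴹ-assoc X' (d • V) (k • V) ⟨
            X' +ᴹ d • V +ᴹ k • V      ∎)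
            where open ≈-Reasoning p

        -- The first component determines k (no-collision) and then the class of A,
        -- hence R⁻¹; the second component then determines A.
        embed : Mat (p ^ n) × Fin p → Triple × Mat (p ^ n)
        embed (A , k) = shifted A (toℕ k) , R⁻¹ (coordsOf A) ∙ A

        shifted-injective : ∀ {A A' k k'} → A ∈ H₁ → A' ∈ H₁ → shifted A (toℕ k) ≡ shifted A' (toℕ k') → k ≡ k'
        shifted-injective {k = k} {k'} A∈ A'∈ e with <-cmp (toℕ k) (toℕ k')
        ... | tri< k<k' _ _ = ⊥-elim (no-collision A∈ A'∈ k<k' (toℕ<n k') e)
        ... | tri≈ _ k≡k' _ = toℕ-injective k≡k'
        ... | tri> _ _ k>k' = ⊥-elim (no-collision A'∈ A∈ k>k' (toℕ<n k) (sym e))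

        shifted-coords : ∀ {A A'} → A ∈ H₁ → A' ∈ H₁ → ∀ i → shifted A i ≡ shifted A' i → coordsOf A ≡ coordsOf A'
        shifted-coords A∈ A'∈ i e = coords-resp (+ᴹ-cancelʳ (i • V)
          (coords-injective (shifted-traceless A∈ i) (shifted-traceless A'∈ i) e))

        embed-injective : ∀ {x y} → x ∈ cartesianProduct H₁ (allFin p) → y ∈ cartesianProduct H₁ (allFin p) →
          embed x ≡ embed y → x ≡ y
        embed-injective {A , k} {A' , k'} x∈ y∈ e = cong₂ _,_ A≡A' k≡k'
          where
          A∈ : A ∈ H₁
          A∈ = proj₁ (∈-cartesianProduct⁻ H₁ (allFin p) x∈)
          A'∈ : A' ∈ H₁
          A'∈ = proj₁ (∈-cartesianProduct⁻ H₁ (allFin p) y∈)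
          k≡k' : k ≡ k'
          k≡k' = shifted-injective A∈ A'∈ (cong proj₁ e)
          same-coords : coordsOf A ≡ coordsOf A'
          same-coords = shifted-coords A∈ A'∈ (toℕ k) (trans (cong proj₁ e) (cong (shifted A' ∘ toℕ) (sym k≡k')))
          A≡A' : A ≡ A'
          A≡A' = R⁻¹-cancel (coordsOf A) (trans (cong proj₂ e) (cong (λ w → R⁻¹ w ∙ A') (sym same-coords)))

        #H-bound : #H p n H (suc j) ≤ p * p * #H p n H (suc (suc j))
        #H-bound = *-cancelʳ-≤ _ _ p (begin
          #H p n H (suc j) * p                        ≡⟨ cong (length H₁ *_) (length-tabulate {n = p} id) ⟨
          length H₁ * length (allFin p)               ≡⟨ length-cartesianProduct H₁ (allFin p) ⟨
          length (cartesianProduct H₁ (allFin p))     ≤⟨ length-≤-injection embed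
                                                           (cartesianProduct⁺ (Hlist-unique (suc j)) (allFin⁺ p))
                                                           embed∈ embed-injective ⟩
          length (cartesianProduct allTriples H₂)     ≡⟨ length-cartesianProduct allTriples H₂ ⟩
          length allTriples * length H₂               ≡⟨ cong (_* length H₂) length-allTriples ⟩
          p * (p * p) * #H p n H (suc (suc j))        ≡⟨ regroup p (length H₂) ⟩
          p * p * #H p n H (suc (suc j)) * p          ∎)
          where
          open ≤-Reasoning
          regroup : ∀ p h → p * (p * p) * h ≡ p * p * h * p
          regroup p h = solve (p ∷ h ∷ [])
          embed∈ : ∀ {x} → x ∈ cartesianProduct H₁ (allFin p) → embed x ∈ cartesianProduct allTriples H₂
          embed∈ {A , k} x∈ = ∈-cartesianProduct⁺
            (∈-cartesianProduct⁺ (∈-allFin _) (∈-cartesianProduct⁺ (∈-allFin _) (∈-allFin _)))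
            (R⁻¹A∈H₂ (proj₁ (∈-cartesianProduct⁻ H₁ (allFin p) x∈)))

      hit⇒Realised : ∀ X → trace X ≡ 0 [mod p ] → Any (λ A → coordsOf A ≡ coords X) H₁ → Realised (suc j) X
      hit⇒Realised X trX hit with find hit
      ... | A , A∈ , e = Realised-resp {suc j} (realised A∈) (coords-injective (traceless A∈) trX e)

      #H-step : ¬ Full (suc j) → #H p n H (suc j) ≤ p * p * #H p n H (suc (suc j))
      #H-step ¬full = decidable-stable (_ ≤? _) λ ¬bound → ¬full λ X trX →
        hit⇒Realised X trX (decidable-stable (any? (λ A → coordsOf A ≟ᵗ coords X) H₁) (¬bound ∘ #H-bound (coords X)))

    #H-descent : Slim p n H → ∀ {t} d → 1 ≤ t → (p ≡ 2 → 2 ≤ t) → t + d ≤ n →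
      #H p n H t ≤ p ^ (2 * d) * #H p n H (t + d)
    #H-descent slim {t} zero _ _ _ = ≤-reflexive (sym (trans (*-identityˡ _) (cong (#H p n H) (+-identityʳ t))))
    #H-descent slim {suc j} (suc d) _ parity le = begin
      #H p n H (suc j)                                   ≤⟨ Count.#H-step le₂ (Slim⇒¬Full slim (s≤s⁻¹ (s≤s⁻¹ le₂)) (s≤s⁻¹ ∘ parity)) ⟩
      p * p * #H p n H (suc (suc j))                     ≤⟨ *-monoʳ-≤ (p * p) (#H-descent slim d (s≤s z≤n) (λ _ → s≤s (s≤s z≤n)) le′) ⟩
      p * p * (p ^ (2 * d) * #H p n H (suc (suc j) + d))  ≡⟨ *-assoc (p * p) _ _ ⟨
      p * p * p ^ (2 * d) * #H p n H (suc (suc j) + d)    ≡⟨ cong (_* #H p n H (suc (suc j) + d)) (*-assoc p p _) ⟩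
      p * (p * p ^ (2 * d)) * #H p n H (suc (suc j) + d)  ≡⟨ cong₂ (λ e t → p ^ e * #H p n H t) (*-suc 2 d) (+-suc (suc j) d) ⟨
      p ^ (2 * suc d) * #H p n H (suc j + suc d)          ∎
      where
      open ≤-Reasoning
      le′ : suc (suc j) + d ≤ n
      le′ = subst (_≤ n) (+-suc (suc j) d) le
      le₂ : suc (suc j) ≤ n
      le₂ = ≤-trans (m≤m+n (suc (suc j)) d) le′

lemma6p1 : (p : ℕ) .{{_ : NonZero p}} → Prime p → (n : ℕ) → 2 ≤ n →
    (H : MatP p n → Bool) → IsSubgroupSL₂ (p ^ n) {{nzN p n}} H → Slim p n H →
    (s t : ℕ) → 1 ≤ t → t < s → s ≤ n → (p ≡ 2 → 2 ≤ t) →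
    #H p n H t ≤ p ^ (2 * (s ∸ t)) * #H p n H s
lemma6p1 p pr 1 (s≤s ()) _ _ _ _ _ _ _ _
lemma6p1 p pr (suc (suc m)) _ H sub slim s t 1≤t t<s s≤n parity =
  subst (λ s′ → #H p n H t ≤ p ^ (2 * (s ∸ t)) * #H p n H s′) t+[s∸t]≡s
    (#H-descent H sub slim (s ∸ t) 1≤t parity (subst (_≤ n) (sym t+[s∸t]≡s) s≤n))
  where
  open Subgroup p pr m
  t+[s∸t]≡s : t + (s ∸ t) ≡ s
  t+[s∸t]≡s = m+[n∸m]≡n (<⇒≤ t<s)
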